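{- Let $\epsilon\ge 0$ and let $G$ be a contracted graph obtained from the all-singleton graph by performing a sequence of $(1+\epsilon)$-good merges. Let $C$ be a subset of the vertices of $G$. Let $m_1,\ldots,m_k$ be a sequence of merges which, applied to $G$ in this order, are each $(1+\epsilon)$-good, and each of which merges two vertices that are vertices of $C$ or were created by earlier merges of vertices of $C$. Let $m'_1,\ldots,m'_l$ be a sequence of merges which, applied to $G$ in this order, are each $(1+\epsilon)$-good, and each of which merges two vertices that are vertices of $V(G)\setminus C$ or were created by earlier merges of such vertices. Then for any interleaving of the two sequences (any sequence of length $k+l$ containing both as subsequences), applying it to $G$ in order, every merge is $(1+\epsilon)$-good.
   Context: $G_0=(V,E,w)$ is a finite undirected graph with positive edge weights. For disjoint nonempty $X,Y\subseteq V$, $w(X,Y)=\frac{1}{|X||Y|}\sum_{xy\in E,x\in X,y\in Y}w(xy)$. Given a partition of $V$ into clusters, the contracted graph has the clusters as vertices and an edge of weight $w(X,Y)$ between $X,Y$ iff $w(X,Y)>0$; initially all clusters are singletons, and merging two adjacent clusters $u,v$ replaces them by $u\cup v$. Min-merge values: $M(v)=\infty$ for singletons, $M(u\cup v)=\min(M(u),M(v),w(u,v))$. $w_{\max}(v)$ is the maximum weight of an edge incident to $v$ in the current graph (0 if none). A merge of adjacent $u,v$ is $(1+\epsilon)$-good (with respect to the current graph) if $\frac{\max(w_{\max}(u),w_{\max}(v))}{\min(M(u),M(v),w(u,v))}\le 1+\epsilon$.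
   Formalization: The edge weights and the parameter ε take rational values rather than real ones. -}

module Defs where

open import Data.Nat as ℕ using (ℕ; zero; suc)
open import Data.Integer using (+_)
open import Data.Rational using (ℚ; 0ℚ; 1ℚ; _+_; _*_; _/_; _⊔_; _⊓_; _≤_; _<_)
open import Data.Fin using (Fin)
open import Data.Fin.Subset using (Subset; _∪_; ⁅_⁆; ∣_∣; ⊥)
open import Data.Vec using (lookup)
open import Data.Vec.Properties using (≡-dec)
open import Data.Bool using (Bool; true; false; if_then_else_)
open import Data.Bool.Properties renaming (_≟_ to _≟B_)
open import Data.List using (List; []; _∷_; foldr; map; filter; allFin)
open import Data.List.Membership.Propositional using (_∈_)
open import Data.Maybe using (Maybe; just; nothing)
open import Data.Product using (_×_; _,_; proj₁; proj₂)
open import Data.Sum using (_⊎_)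
open import Data.Unit using (⊤)
open import Relation.Nullary using (¬_; yes; no; does)
open import Relation.Binary.PropositionalEquality using (_≡_)

_≟S_ : ∀ {n} (X Y : Subset n) → Relation.Nullary.Dec (X ≡ Y)
_≟S_ = ≡-dec _≟B_

Σ : ∀ {n} → (Fin n → ℚ) → ℚ
Σ {n} f = foldr (λ i acc → f i + acc) 0ℚ (allFin n)

-- q / k in ℚ (k = 0 never occurs for nonempty clusters; set to 0 then)
divℕ : ℚ → ℕ → ℚ
divℕ q zero = 0ℚ
divℕ q (suc k) = q * ((+ 1) / suc k)

-- Base weighted graph on vertex set Fin n: W x y = weight of edge xy (0 = no edge).
-- w(X,Y) = (1/(|X||Y|)) Σ_{x∈X, y∈Y} W x y
wt : ∀ {n} → (Fin n → Fin n → ℚ) → Subset n → Subset n → ℚ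
wt W X Y = divℕ (Σ (λ x → if lookup X x then Σ (λ y → if lookup Y y then W x y else 0ℚ) else 0ℚ))
                (∣ X ∣ ℕ.* ∣ Y ∣)

-- extended rationals for min-merge values: nothing = ∞
ℚ∞ : Set
ℚ∞ = Maybe ℚ

min∞ : ℚ∞ → ℚ → ℚ
min∞ nothing q = q
min∞ (just p) q = p ⊓ q

-- State of the contracted graph: list of clusters (the vertices) and the min-merge value M
record State (n : ℕ) : Set where
  constructor st
  field
    clusters : List (Subset n)
    M        : Subset n → ℚ∞
open State public

initial : (n : ℕ) → State n
initial n = st (map ⁅_⁆ (allFin n)) (λ _ → nothing)

Merge : ℕ → Set
Merge n = Subset n × Subset n

-- w_max(X): maximum weight of an edge from X to another current cluster (0 if none)
wmax : ∀ {n} → (Fin n → Fin n → ℚ) → State n → Subset n → ℚ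
wmax W s X = foldr (λ Z acc → if does (Z ≟S X) then acc else (wt W X Z ⊔ acc)) 0ℚ (clusters s)

merge : ∀ {n} → (Fin n → Fin n → ℚ) → State n → Merge n → State n
merge W s (X , Y) =
  st ((X ∪ Y) ∷ filter (λ Z → ¬? (Z ≟S Y)) (filter (λ Z → ¬? (Z ≟S X)) (clusters s)))
     (λ Z → if does (Z ≟S (X ∪ Y))
              then just (min∞ (M s X) (min∞ (M s Y) (wt W X Y)))
              else M s Z)
  where open import Relation.Nullary.Decidable using (¬?)

run : ∀ {n} → (Fin n → Fin n → ℚ) → State n → List (Merge n) → State n
run W s [] = s
run W s (m ∷ ms) = run W (merge W s m) ms

Valid : ∀ {n} → (Fin n → Fin n → ℚ) → State n → Merge n → Set
Valid W s (X , Y) = X ∈ clusters s × Y ∈ clusters s × ¬ (X ≡ Y) × 0ℚ < wt W X Y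

-- (1+ε)-good: max(wmax X, wmax Y) / min(M X, M Y, w(X,Y)) ≤ 1+ε,
-- written multiplicatively (the denominator is > 0 for valid merges)
Good : ∀ {n} → (Fin n → Fin n → ℚ) → ℚ → State n → Merge n → Set
Good W ε s (X , Y) =
  (wmax W s X ⊔ wmax W s Y) ≤ (1ℚ + ε) * min∞ (M s X) (min∞ (M s Y) (wt W X Y))

GoodSeq : ∀ {n} → (Fin n → Fin n → ℚ) → ℚ → State n → List (Merge n) → Set
GoodSeq W ε s [] = ⊤
GoodSeq W ε s (m ∷ ms) = Valid W s m × Good W ε s m × GoodSeq W ε (merge W s m) ms

-- each merge merges two vertices that are base vertices (satisfy B) or were
-- created by earlier merges of the sequence (recorded in 'created')
Within : ∀ {n} → (Subset n → Set) → List (Subset n) → List (Merge n) → Set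
Within B created [] = ⊤
Within B created ((X , Y) ∷ ms) =
  (B X ⊎ X ∈ created) × (B Y ⊎ Y ∈ created) × Within B ((X ∪ Y) ∷ created) ms

{-# OPTIONS --safe #-}
-- The merges inside C and those outside C do not interact. Compare the interleaved run with the
-- run performing the C-merges alone: a current cluster of the interleaved run is either a cluster
-- of that run or a union of original clusters outside C. Those original clusters are untouched
-- by C-merges, so they are still clusters of the C-only run, and the weight from a cluster A to a
-- disjoint union is a weighted average of the weights to its parts. Hence w_max of a C-cluster is
-- no larger in the interleaved run than in the C-only run, while M and w(X, Y) agree, so every
-- (1+ε)-good C-merge stays (1+ε)-good; the other side is symmetric.
module Submission where

open import Defs
open import Data.Bool using (true; false; _∨_; if_then_else_)
open import Data.Empty using (⊥; ⊥-elim)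
open import Data.Fin using (Fin; zero; suc)
open import Data.Fin.Subset using (Subset; _∪_; ⁅_⁆; ∣_∣; Nonempty) renaming (_∈_ to _∈ₛ_)
open import Data.Fin.Subset.Properties using (x∈p∪q⁻; x∈p∪q⁺; x∈⁅x⁆; x∈⁅y⁆⇒x≡y; ∣p∣≤∣x∷p∣)
open import Data.List using (List; []; _∷_; foldr; allFin)
open import Data.List.Membership.Propositional using (_∈_)
open import Data.List.Membership.Propositional.Properties using (∈-filter⁺; ∈-filter⁻; ∈-map⁻)
open import Data.List.Relation.Unary.All as All using (All; _∷_)
open import Data.List.Relation.Unary.Any using (here; there)
open import Data.List.Relation.Ternary.Interleaving using ([])
open import Data.List.Relation.Ternary.Interleaving.Propositional using (Interleaving; consˡ; consʳ)
open import Data.Maybe using (just)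
open import Data.Nat as ℕ using (ℕ; suc; z≤n; s≤s)
import Data.Nat.Properties as ℕ
open import Data.Product using (_×_; _,_; proj₁)
open import Data.Integer as ℤ using (+_)
import Data.Integer.Properties as ℤ
open import Data.Rational using (ℚ; 0ℚ; 1ℚ; _+_; _*_; 1/_; _≤_)
open import Data.Rational.Literals using (fromℤ)
open import Data.Rational.Properties
import Data.Rational.Unnormalised as ℚᵘ
import Data.Rational.Unnormalised.Properties as ℚᵘ
open import Data.Sum using (_⊎_; inj₁; inj₂; [_,_]′; map₁)
open import Data.Unit using (tt)
open import Data.Vec using ([]; _∷_; lookup; here; there)
open import Data.Vec.Properties using (lookup-zipWith; lookup⇒[]=)
open import Algebra.Bundles using (CommutativeMonoid)
open import Algebra.Properties.CommutativeSemigroup (CommutativeMonoid.commutativeSemigroup +-0-commutativeMonoid)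
  using (interchange)
open import Function using (flip; _∘_; _∘₂_)
open import Relation.Nullary using (¬_; yes; no)
open import Relation.Nullary.Decidable using (¬?)
open import Relation.Binary.PropositionalEquality

private
  variable
    n : ℕ
    s : State n
    A B X Y Z Z′ : Subset n

Disjoint : Subset n → Subset n → Set
Disjoint A B = ∀ {x} → x ∈ₛ A → x ∈ₛ B → ⊥

disjoint-∪ˡ : Disjoint X Z → Disjoint Y Z → Disjoint (X ∪ Y) Z
disjoint-∪ˡ {X = X} {Y = Y} X#Z Y#Z x∈X∪Y x∈Z =
  [ (λ x∈X → X#Z x∈X x∈Z) , (λ x∈Y → Y#Z x∈Y x∈Z) ]′ (x∈p∪q⁻ X Y x∈X∪Y)

disjoint-∪ʳ : Disjoint Z X → Disjoint Z Y → Disjoint Z (X ∪ Y)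
disjoint-∪ʳ Z#X Z#Y x∈Z x∈X∪Y = disjoint-∪ˡ (flip Z#X) (flip Z#Y) x∈X∪Y x∈Z

nonempty-disjoint⇒≢ : Nonempty X → Disjoint X Y → X ≢ Y
nonempty-disjoint⇒≢ (x , x∈X) X#Y refl = X#Y x∈X x∈X

∣p∪q∣≡∣p∣+∣q∣ : ∀ (A B : Subset n) → Disjoint A B → ∣ A ∪ B ∣ ≡ ∣ A ∣ ℕ.+ ∣ B ∣
∣p∪q∣≡∣p∣+∣q∣ []          []          _   = refl
∣p∪q∣≡∣p∣+∣q∣ (true ∷ A)  (true ∷ B)  A#B = ⊥-elim (A#B here here)
∣p∪q∣≡∣p∣+∣q∣ (true ∷ A)  (false ∷ B) A#B = cong suc (∣p∪q∣≡∣p∣+∣q∣ A B λ a b → A#B (there a) (there b))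
∣p∪q∣≡∣p∣+∣q∣ (false ∷ A) (true ∷ B)  A#B =
  trans (cong suc (∣p∪q∣≡∣p∣+∣q∣ A B λ a b → A#B (there a) (there b))) (sym (ℕ.+-suc ∣ A ∣ ∣ B ∣))
∣p∪q∣≡∣p∣+∣q∣ (false ∷ A) (false ∷ B) A#B = ∣p∪q∣≡∣p∣+∣q∣ A B λ a b → A#B (there a) (there b)

nonempty⇒∣p∣>0 : Nonempty A → 0 ℕ.< ∣ A ∣
nonempty⇒∣p∣>0 (zero , here) = s≤s z≤n
nonempty⇒∣p∣>0 {A = a ∷ A} (suc x , there x∈A) = ℕ.≤-trans (nonempty⇒∣p∣>0 (x , x∈A)) (∣p∣≤∣x∷p∣ a A)

nonempty⇒nonZero : Nonempty A → ℕ.NonZero ∣ A ∣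
nonempty⇒nonZero = ℕ.>-nonZero ∘ nonempty⇒∣p∣>0

divℕ-suc : ∀ s k → divℕ s (suc k) ≡ s * 1/ fromℤ (+ suc k)
divℕ-suc s k = cong (s *_) (toℚᵘ-injective (toℚᵘ-fromℚᵘ (ℚᵘ.mkℚᵘ (+ 1) k)))

fromℤ-+ : ∀ m n → fromℤ (+ (m ℕ.+ n)) ≡ fromℤ (+ m) + fromℤ (+ n)
fromℤ-+ m n =
  toℚᵘ-injective (ℚᵘ.≃-trans (ℚᵘ.*≡* numerators) (ℚᵘ.≃-sym (toℚᵘ-homo-+ (fromℤ (+ m)) (fromℤ (+ n)))))
  where
  numerators : + (m ℕ.+ n) ℤ.* + 1 ≡ (+ m ℤ.* + 1 ℤ.+ + n ℤ.* + 1) ℤ.* + 1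
  numerators rewrite ℤ.*-identityʳ (+ m) | ℤ.*-identityʳ (+ n) = cong (ℤ._* + 1) (ℤ.pos-+ m n)

divℕ≤⇒≤* : ∀ {s b} k → divℕ s (suc k) ≤ b → s ≤ b * fromℤ (+ suc k)
divℕ≤⇒≤* {s} {b} k h = begin
  s                   ≡⟨ sym (*-identityʳ s) ⟩
  s * 1ℚ              ≡⟨ cong (s *_) (sym (*-inverseˡ d)) ⟩
  s * (1/ d * d)      ≡⟨ sym (*-assoc s (1/ d) d) ⟩
  s * 1/ d * d        ≡⟨ cong (_* d) (sym (divℕ-suc s k)) ⟩
  divℕ s (suc k) * d  ≤⟨ *-monoʳ-≤-nonNeg d h ⟩
  b * d               ∎
  where open ≤-Reasoning
        d = fromℤ (+ suc k)

≤*⇒divℕ≤ : ∀ {s b} k → s ≤ b * fromℤ (+ suc k) → divℕ s (suc k) ≤ b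
≤*⇒divℕ≤ {s} {b} k h = begin
  divℕ s (suc k)   ≡⟨ divℕ-suc s k ⟩
  s * 1/ d         ≤⟨ *-monoʳ-≤-nonNeg (1/ d) h ⟩
  b * d * 1/ d     ≡⟨ *-assoc b d (1/ d) ⟩
  b * (d * 1/ d)   ≡⟨ cong (b *_) (*-inverseʳ d) ⟩
  b * 1ℚ           ≡⟨ *-identityʳ b ⟩
  b                ∎
  where open ≤-Reasoning
        d = fromℤ (+ suc k)

divℕ-mediant : ∀ {s₁ s₂ b} m₁ m₂ .{{_ : ℕ.NonZero m₁}} .{{_ : ℕ.NonZero m₂}} →
               divℕ s₁ m₁ ≤ b → divℕ s₂ m₂ ≤ b → divℕ (s₁ + s₂) (m₁ ℕ.+ m₂) ≤ b
divℕ-mediant {s₁} {s₂} {b} (suc k₁) (suc k₂) h₁ h₂ = ≤*⇒divℕ≤ (k₁ ℕ.+ suc k₂) (begin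
  s₁ + s₂                                   ≤⟨ +-mono-≤ (divℕ≤⇒≤* {s₁} k₁ h₁) (divℕ≤⇒≤* {s₂} k₂ h₂) ⟩
  b * fromℤ (+ suc k₁) + b * fromℤ (+ suc k₂) ≡⟨ sym (*-distribˡ-+ b _ _) ⟩
  b * (fromℤ (+ suc k₁) + fromℤ (+ suc k₂))   ≡⟨ cong (b *_) (sym (fromℤ-+ (suc k₁) (suc k₂))) ⟩
  b * fromℤ (+ (suc k₁ ℕ.+ suc k₂))           ∎)
  where open ≤-Reasoning

sumOver : List (Fin n) → (Fin n → ℚ) → ℚ
sumOver is f = foldr (λ i acc → f i + acc) 0ℚ is

sumOver-cong : ∀ (is : List (Fin n)) {f g} → (∀ i → f i ≡ g i) → sumOver is f ≡ sumOver is g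
sumOver-cong []       f≗g = refl
sumOver-cong (i ∷ is) f≗g = cong₂ _+_ (f≗g i) (sumOver-cong is f≗g)

sumOver-+ : ∀ (is : List (Fin n)) f g → sumOver is (λ i → f i + g i) ≡ sumOver is f + sumOver is g
sumOver-+ []       f g = sym (+-identityʳ 0ℚ)
sumOver-+ (i ∷ is) f g =
  trans (cong (_+_ (f i + g i)) (sumOver-+ is f g)) (interchange (f i) (g i) (sumOver is f) (sumOver is g))

if-+ : ∀ b {u v w : ℚ} → u ≡ v + w → (if b then u else 0ℚ) ≡ (if b then v else 0ℚ) + (if b then w else 0ℚ)
if-+ true  u≡v+w = u≡v+w
if-+ false _     = sym (+-identityʳ 0ℚ)

if-∪ : Disjoint A B → ∀ x (v : ℚ) →
       (if lookup (A ∪ B) x then v else 0ℚ) ≡ (if lookup A x then v else 0ℚ) + (if lookup B x then v else 0ℚ)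
if-∪ {A = A} {B = B} A#B x v rewrite lookup-zipWith _∨_ x A B with lookup A x in x∈A | lookup B x in x∈B
... | true  | true  = ⊥-elim (A#B (lookup⇒[]= x A x∈A) (lookup⇒[]= x B x∈B))
... | true  | false = sym (+-identityʳ v)
... | false | true  = sym (+-identityˡ v)
... | false | false = sym (+-identityʳ 0ℚ)

-- wt W X Y unfolds to divℕ (cut W X Y) (∣ X ∣ ℕ.* ∣ Y ∣).
cut : (Fin n → Fin n → ℚ) → Subset n → Subset n → ℚ
cut W X Y = Σ (λ x → if lookup X x then Σ (λ y → if lookup Y y then W x y else 0ℚ) else 0ℚ)

cut-∪ : ∀ W X → Disjoint A B → cut {n} W X (A ∪ B) ≡ cut W X A + cut W X B
cut-∪ {n} {A} {B} W X A#B = trans (sumOver-cong (allFin n) split) (sumOver-+ (allFin n) (row A) (row B))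
  where
  entry : Subset n → Fin n → Fin n → ℚ
  entry Y x y = if lookup Y y then W x y else 0ℚ
  row : Subset n → Fin n → ℚ
  row Y x = if lookup X x then Σ (entry Y x) else 0ℚ
  split : ∀ x → row (A ∪ B) x ≡ row A x + row B x
  split x = if-+ (lookup X x)
    (trans (sumOver-cong (allFin n) (λ y → if-∪ A#B y (W x y))) (sumOver-+ (allFin n) (entry A x) (entry B x)))

wt-∪-≤ : ∀ W X {b : ℚ} → Nonempty X → Nonempty A → Nonempty B → Disjoint A B →
         wt {n} W X A ≤ b → wt W X B ≤ b → wt W X (A ∪ B) ≤ b
wt-∪-≤ {A = A} {B = B} W X {b} neX neA neB A#B =
  subst₂ (λ s m → divℕ s m ≤ b) (sym (cut-∪ W X A#B)) (sym size-∪)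
    ∘₂ divℕ-mediant (∣ X ∣ ℕ.* ∣ A ∣) (∣ X ∣ ℕ.* ∣ B ∣) {{∣X∣∣A∣≢0}} {{∣X∣∣B∣≢0}}
  where
  size-∪ : ∣ X ∣ ℕ.* ∣ A ∪ B ∣ ≡ ∣ X ∣ ℕ.* ∣ A ∣ ℕ.+ ∣ X ∣ ℕ.* ∣ B ∣
  size-∪ = trans (cong (∣ X ∣ ℕ.*_) (∣p∪q∣≡∣p∣+∣q∣ A B A#B)) (ℕ.*-distribˡ-+ (∣ X ∣) (∣ A ∣) (∣ B ∣))
  ∣X∣∣A∣≢0 = ℕ.m*n≢0 (∣ X ∣) (∣ A ∣) {{nonempty⇒nonZero neX}} {{nonempty⇒nonZero neA}}
  ∣X∣∣B∣≢0 = ℕ.m*n≢0 (∣ X ∣) (∣ B ∣) {{nonempty⇒nonZero neX}} {{nonempty⇒nonZero neB}}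

wmax-nonneg : ∀ W (s : State n) X → 0ℚ ≤ wmax W s X
wmax-nonneg W (st cs M) X = go cs
  where
  go : ∀ cs → 0ℚ ≤ wmax W (st cs M) X
  go []       = ≤-refl
  go (Z ∷ cs) with Z ≟S X
  ... | yes _ = go cs
  ... | no  _ = ≤-trans (go cs) (p≤q⊔p (wt W X Z) _)

wmax-ub : ∀ W (s : State n) {X Z} → Z ∈ clusters s → Z ≢ X → wt W X Z ≤ wmax W s X
wmax-ub W (st (Z′ ∷ cs) M) {X} (here refl) Z≢X with Z′ ≟S X
... | yes Z≡X = ⊥-elim (Z≢X Z≡X)
... | no  _   = p≤p⊔q _ _
wmax-ub W (st (Z′ ∷ cs) M) {X} (there Z∈cs) Z≢X with Z′ ≟S X
... | yes _ = wmax-ub W (st cs M) Z∈cs Z≢X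
... | no  _ = ≤-trans (wmax-ub W (st cs M) Z∈cs Z≢X) (p≤q⊔p (wt W X Z′) _)

wmax-lub : ∀ W (s : State n) {X b} → 0ℚ ≤ b →
           (∀ {Z} → Z ∈ clusters s → Z ≢ X → wt W X Z ≤ b) → wmax W s X ≤ b
wmax-lub W (st cs M) {X} {b} 0≤b = go cs
  where
  go : ∀ cs → (∀ {Z} → Z ∈ cs → Z ≢ X → wt W X Z ≤ b) → wmax W (st cs M) X ≤ b
  go []       ub = 0≤b
  go (Z ∷ cs) ub with Z ≟S X
  ... | yes _   = go cs (ub ∘ there)
  ... | no  Z≢X = ⊔-lub (ub (here refl) Z≢X) (go cs (ub ∘ there))

∈-merge⁻ : ∀ W (s : State n) {X Y Z} → Z ∈ clusters (merge W s (X , Y)) →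
           Z ≡ X ∪ Y ⊎ (Z ∈ clusters s × Z ≢ X × Z ≢ Y)
∈-merge⁻ W s (here Z≡X∪Y) = inj₁ Z≡X∪Y
∈-merge⁻ W s {X} {Y} (there Z∈) with ∈-filter⁻ (λ Z → ¬? (Z ≟S Y)) Z∈
... | Z∈′ , Z≢Y with ∈-filter⁻ (λ Z → ¬? (Z ≟S X)) {xs = clusters s} Z∈′
... | Z∈s , Z≢X = inj₂ (Z∈s , Z≢X , Z≢Y)

∈-merge⁺ : ∀ W (s : State n) {X Y Z} → Z ∈ clusters s → Z ≢ X → Z ≢ Y →
           Z ∈ clusters (merge W s (X , Y))
∈-merge⁺ W s {X} {Y} Z∈s Z≢X Z≢Y =
  there (∈-filter⁺ (λ Z → ¬? (Z ≟S Y)) (∈-filter⁺ (λ Z → ¬? (Z ≟S X)) Z∈s Z≢X) Z≢Y)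

M-merge-≢ : ∀ W (s : State n) {X Y Z} → Z ≢ X ∪ Y → M (merge W s (X , Y)) Z ≡ M s Z
M-merge-≢ W s {X} {Y} {Z} Z≢X∪Y with Z ≟S (X ∪ Y)
... | yes Z≡X∪Y = ⊥-elim (Z≢X∪Y Z≡X∪Y)
... | no  _     = refl

M-merge-cong : ∀ W (s s′ : State n) {X Y Z} → M s X ≡ M s′ X → M s Y ≡ M s′ Y → M s Z ≡ M s′ Z →
               M (merge W s (X , Y)) Z ≡ M (merge W s′ (X , Y)) Z
M-merge-cong W s s′ {X} {Y} {Z} eX eY eZ with Z ≟S (X ∪ Y)
... | yes _ = cong just (cong₂ min∞ eX (cong (λ m → min∞ m (wt W X Y)) eY))
... | no  _ = eZ

good-transfer : ∀ W ε (s s′ : State n) {X Y} → wmax W s X ≤ wmax W s′ X → wmax W s Y ≤ wmax W s′ Y →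
                M s X ≡ M s′ X → M s Y ≡ M s′ Y → Good W ε s′ (X , Y) → Good W ε s (X , Y)
good-transfer W ε s s′ wX wY eX eY good rewrite eX | eY = ≤-trans (⊔-mono-≤ wX wY) good

record Clustering (s : State n) : Set where
  field
    nonempty : Z ∈ clusters s → Nonempty Z
    disjoint : X ∈ clusters s → Y ∈ clusters s → X ≢ Y → Disjoint X Y
open Clustering

clustering-initial : Clustering (initial n)
clustering-initial {n} = record { nonempty = nonempty′ ; disjoint = disjoint′ }
  where
  nonempty′ : Z ∈ clusters (initial n) → Nonempty Z
  nonempty′ Z∈ with ∈-map⁻ ⁅_⁆ Z∈
  ... | i , _ , refl = i , x∈⁅x⁆ i
  disjoint′ : X ∈ clusters (initial n) → Y ∈ clusters (initial n) → X ≢ Y → Disjoint X Y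
  disjoint′ X∈ Y∈ X≢Y x∈X x∈Y with ∈-map⁻ ⁅_⁆ X∈ | ∈-map⁻ ⁅_⁆ Y∈
  ... | i , _ , refl | j , _ , refl = X≢Y (cong ⁅_⁆ (trans (sym (x∈⁅y⁆⇒x≡y i x∈X)) (x∈⁅y⁆⇒x≡y j x∈Y)))

clustering-merge : ∀ W {X Y} → Clustering s → Valid W s (X , Y) → Clustering (merge W s (X , Y))
clustering-merge {s = s} W {X} {Y} cl (X∈ , Y∈ , X≢Y , _) =
  record { nonempty = nonempty′ ; disjoint = disjoint′ }
  where
  X∪Y#rest : ∀ {Z} → Z ∈ clusters s → Z ≢ X → Z ≢ Y → Disjoint (X ∪ Y) Z
  X∪Y#rest Z∈ Z≢X Z≢Y = disjoint-∪ˡ (disjoint cl X∈ Z∈ (≢-sym Z≢X)) (disjoint cl Y∈ Z∈ (≢-sym Z≢Y))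
  nonempty′ : Z ∈ clusters (merge W s (X , Y)) → Nonempty Z
  nonempty′ Z∈ with ∈-merge⁻ W s Z∈
  ... | inj₁ refl = let x , x∈X = nonempty cl X∈ in x , x∈p∪q⁺ (inj₁ x∈X)
  ... | inj₂ (Z∈s , _) = nonempty cl Z∈s
  disjoint′ : Z ∈ clusters (merge W s (X , Y)) → Z′ ∈ clusters (merge W s (X , Y)) → Z ≢ Z′ →
              Disjoint Z Z′
  disjoint′ Z∈ Z′∈ Z≢Z′ with ∈-merge⁻ W s Z∈ | ∈-merge⁻ W s Z′∈
  ... | inj₁ refl | inj₁ refl = ⊥-elim (Z≢Z′ refl)
  ... | inj₁ refl | inj₂ (Z′∈s , Z′≢X , Z′≢Y) = X∪Y#rest Z′∈s Z′≢X Z′≢Y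
  ... | inj₂ (Z∈s , Z≢X , Z≢Y) | inj₁ refl = flip (X∪Y#rest Z∈s Z≢X Z≢Y)
  ... | inj₂ (Z∈s , _) | inj₂ (Z′∈s , _) = disjoint cl Z∈s Z′∈s Z≢Z′

clustering-run : ∀ W ε (s : State n) ms → Clustering s → GoodSeq W ε s ms → Clustering (run W s ms)
clustering-run W ε s []       cl _                   = cl
clustering-run W ε s (m ∷ ms) cl (valid , _ , goods) =
  clustering-run W ε (merge W s m) ms (clustering-merge W cl valid) goods

data Merged (B : Subset n → Set) : Subset n → Set where
  base : B Z → Merged B Z
  node : Merged B X → Merged B Y → Disjoint X Y → Merged B (X ∪ Y)

module Interleaved (W : Fin n → Fin n → ℚ) (ε : ℚ) {G : State n} (G-clustering : Clustering G) where

  Base : (Subset n → Set) → Subset n → Set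
  Base P K = K ∈ clusters G × P K

  MergedFrom : (Subset n → Set) → Subset n → Set
  MergedFrom P = Merged (Base P)

  merged-nonempty : ∀ {P} → MergedFrom P Z → Nonempty Z
  merged-nonempty (base (K∈G , _)) = nonempty G-clustering K∈G
  merged-nonempty (node mX _ _)    = let x , x∈X = merged-nonempty mX in x , x∈p∪q⁺ (inj₁ x∈X)

  module _ {P Q : Subset n → Set} (P#Q : ∀ {K} → P K → Q K → ⊥) where

    merged-disjoint : MergedFrom P Z → MergedFrom Q Z′ → Disjoint Z Z′
    merged-disjoint (node mX mY _) mZ = disjoint-∪ˡ (merged-disjoint mX mZ) (merged-disjoint mY mZ)
    merged-disjoint (base K) (node mX mY _) =
      disjoint-∪ʳ (merged-disjoint (base K) mX) (merged-disjoint (base K) mY)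
    merged-disjoint (base (K∈G , pK)) (base (K′∈G , qK′)) =
      disjoint G-clustering K∈G K′∈G λ { refl → P#Q pK qK′ }

    merged-≢ : MergedFrom P Z → MergedFrom Q Z′ → Z ≢ Z′
    merged-≢ mZ mZ′ = nonempty-disjoint⇒≢ (merged-nonempty mZ) (merged-disjoint mZ mZ′)

  -- s is reached from G by interleaving P-merges and Q-merges, sP and sQ by the same P-merges and
  -- the same Q-merges alone.
  record Simulation (P Q : Subset n → Set) (sP sQ s : State n) : Set where
    field
      clustering : Clustering s
      lift-P     : MergedFrom P Z → Z ∈ clusters sP → Z ∈ clusters s
      lift-Q     : MergedFrom Q Z → Z ∈ clusters sQ → Z ∈ clusters s
      M-P        : MergedFrom P Z → M s Z ≡ M sP Z
      M-Q        : MergedFrom Q Z → M s Z ≡ M sQ Z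
      from-P     : Z ∈ clusters s → Z ∈ clusters sP ⊎ MergedFrom Q Z
      from-Q     : Z ∈ clusters s → Z ∈ clusters sQ ⊎ MergedFrom P Z
      Q-kept     : Base Q Z → Z ∈ clusters sP
      P-kept     : Base P Z → Z ∈ clusters sQ
  open Simulation

  simulation-start : ∀ {P Q} → Simulation P Q G G G
  simulation-start = record
    { clustering = G-clustering
    ; lift-P = λ _ Z∈ → Z∈ ; lift-Q = λ _ Z∈ → Z∈
    ; M-P = λ _ → refl     ; M-Q = λ _ → refl
    ; from-P = inj₁        ; from-Q = inj₁
    ; Q-kept = proj₁       ; P-kept = proj₁
    }

  simulation-swap : ∀ {P Q sP sQ s} → Simulation P Q sP sQ s → Simulation Q P sQ sP s
  simulation-swap sim = record
    { clustering = clustering sim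
    ; lift-P = lift-Q sim ; lift-Q = lift-P sim
    ; M-P = M-Q sim       ; M-Q = M-P sim
    ; from-P = from-Q sim ; from-Q = from-P sim
    ; Q-kept = P-kept sim ; P-kept = Q-kept sim
    }

  module _ {P Q : Subset n → Set} (P#Q : ∀ {K} → P K → Q K → ⊥)
           {sP sQ s : State n} (sim : Simulation P Q sP sQ s) where

    wt-merged≤wmax : MergedFrom P A → MergedFrom Q Z → wt W A Z ≤ wmax W sP A
    wt-merged≤wmax mA (base K) = wmax-ub W sP (Q-kept sim K) (≢-sym (merged-≢ P#Q mA (base K)))
    wt-merged≤wmax mA (node mX mY X#Y) =
      wt-∪-≤ W _ (merged-nonempty mA) (merged-nonempty mX) (merged-nonempty mY) X#Y
        (wt-merged≤wmax mA mX) (wt-merged≤wmax mA mY)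

    wmax≤wmax : MergedFrom P A → wmax W s A ≤ wmax W sP A
    wmax≤wmax mA = wmax-lub W s (wmax-nonneg W sP _) λ Z∈ Z≢A →
      [ (λ Z∈sP → wmax-ub W sP Z∈sP Z≢A) , wt-merged≤wmax mA ]′ (from-P sim Z∈)

    module _ {X Y} (mX : MergedFrom P X) (mY : MergedFrom P Y) (valid : Valid W sP (X , Y)) where

      valid-lift : Valid W s (X , Y)
      valid-lift = let X∈ , Y∈ , rest = valid in lift-P sim mX X∈ , lift-P sim mY Y∈ , rest

      good-lift : Good W ε sP (X , Y) → Good W ε s (X , Y)
      good-lift = good-transfer W ε s sP (wmax≤wmax mX) (wmax≤wmax mY) (M-P sim mX) (M-P sim mY)

      merged-∪ : MergedFrom P (X ∪ Y)
      merged-∪ = let X∈ , Y∈ , X≢Y , _ = valid-lift in node mX mY (disjoint (clustering sim) X∈ Y∈ X≢Y)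

      simulation-merge : Simulation P Q (merge W sP (X , Y)) sQ (merge W s (X , Y))
      simulation-merge = record
        { clustering = clustering-merge W (clustering sim) valid-lift
        ; lift-P = lift-P′
        ; lift-Q = λ mZ Z∈ → ∈-merge⁺ W s (lift-Q sim mZ Z∈) (≢X mZ) (≢Y mZ)
        ; M-P = λ mZ → M-merge-cong W s sP (M-P sim mX) (M-P sim mY) (M-P sim mZ)
        ; M-Q = λ mZ → trans (M-merge-≢ W s (≢-sym (merged-≢ P#Q merged-∪ mZ))) (M-Q sim mZ)
        ; from-P = from-P′
        ; from-Q = from-Q′
        ; Q-kept = λ K → ∈-merge⁺ W sP (Q-kept sim K) (≢X (base K)) (≢Y (base K))
        ; P-kept = P-kept sim
        }
        where
        ≢X : MergedFrom Q Z → Z ≢ X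
        ≢X mZ = ≢-sym (merged-≢ P#Q mX mZ)
        ≢Y : MergedFrom Q Z → Z ≢ Y
        ≢Y mZ = ≢-sym (merged-≢ P#Q mY mZ)
        lift-P′ : MergedFrom P Z → Z ∈ clusters (merge W sP (X , Y)) →
                  Z ∈ clusters (merge W s (X , Y))
        lift-P′ mZ Z∈ with ∈-merge⁻ W sP Z∈
        ... | inj₁ Z≡X∪Y = here Z≡X∪Y
        ... | inj₂ (Z∈sP , Z≢X , Z≢Y) = ∈-merge⁺ W s (lift-P sim mZ Z∈sP) Z≢X Z≢Y
        from-P′ : Z ∈ clusters (merge W s (X , Y)) →
                  Z ∈ clusters (merge W sP (X , Y)) ⊎ MergedFrom Q Z
        from-P′ Z∈ with ∈-merge⁻ W s Z∈
        ... | inj₁ Z≡X∪Y = inj₁ (here Z≡X∪Y)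
        ... | inj₂ (Z∈s , Z≢X , Z≢Y) = map₁ (λ Z∈sP → ∈-merge⁺ W sP Z∈sP Z≢X Z≢Y) (from-P sim Z∈s)
        from-Q′ : Z ∈ clusters (merge W s (X , Y)) → Z ∈ clusters sQ ⊎ MergedFrom P Z
        from-Q′ Z∈ with ∈-merge⁻ W s Z∈
        ... | inj₁ refl = inj₂ merged-∪
        ... | inj₂ (Z∈s , _) = from-Q sim Z∈s

  within⇒merged : ∀ {P cs} → All (MergedFrom P) cs → Base P X ⊎ X ∈ cs → MergedFrom P X
  within⇒merged all = [ base , All.lookup all ]′

  goodSeq-interleaving : ∀ {P Q} (P#Q : ∀ {K} → P K → Q K → ⊥) {sP sQ s : State n} →
                         Simulation P Q sP sQ s →
                         ∀ {cP cQ ms ms′ is} → All (MergedFrom P) cP → All (MergedFrom Q) cQ →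
                         GoodSeq W ε sP ms → Within (Base P) cP ms →
                         GoodSeq W ε sQ ms′ → Within (Base Q) cQ ms′ →
                         Interleaving ms ms′ is → GoodSeq W ε s is
  goodSeq-interleaving P#Q sim _ _ _ _ _ _ [] = tt
  goodSeq-interleaving P#Q sim mcP mcQ (valid , good , goods) (wX , wY , within) goods′ within′ (consˡ il) =
    valid-lift P#Q sim mX mY valid , good-lift P#Q sim mX mY valid good ,
    goodSeq-interleaving P#Q (simulation-merge P#Q sim mX mY valid)
      (merged-∪ P#Q sim mX mY valid ∷ mcP) mcQ goods within goods′ within′ il
    where
    mX = within⇒merged mcP wX
    mY = within⇒merged mcP wY
  goodSeq-interleaving {P} {Q} P#Q sim mcP mcQ goods within
                       (valid , good , goods′) (wX , wY , within′) (consʳ il) =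
    valid-lift Q#P sim′ mX mY valid , good-lift Q#P sim′ mX mY valid good ,
    goodSeq-interleaving P#Q (simulation-swap (simulation-merge Q#P sim′ mX mY valid))
      mcP (merged-∪ Q#P sim′ mX mY valid ∷ mcQ) goods within goods′ within′ il
    where
    Q#P : ∀ {K} → Q K → P K → ⊥
    Q#P = flip P#Q
    sim′ = simulation-swap sim
    mX = within⇒merged mcQ wX
    mY = within⇒merged mcQ wY

lemma4p3 : {n : ℕ} (W : Fin n → Fin n → ℚ)
    → (∀ x y → W x y ≡ W y x) → (∀ x y → 0ℚ ≤ W x y)
    → (ε : ℚ) → 0ℚ ≤ ε
    → (ms₀ : List (Merge n)) → GoodSeq W ε (initial n) ms₀
    → (C : Subset n → Set)
    → (ms ms′ : List (Merge n))
    → GoodSeq W ε (run W (initial n) ms₀) ms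
    → Within (λ X → X ∈ clusters (run W (initial n) ms₀) × C X) [] ms
    → GoodSeq W ε (run W (initial n) ms₀) ms′
    → Within (λ X → X ∈ clusters (run W (initial n) ms₀) × ¬ C X) [] ms′
    → (is : List (Merge n)) → Interleaving ms ms′ is
    → GoodSeq W ε (run W (initial n) ms₀) is
lemma4p3 {n} W _ _ ε _ ms₀ goods₀ C ms ms′ goods within goods′ within′ is il =
  goodSeq-interleaving (λ c ¬c → ¬c c) simulation-start All.[] All.[] goods within goods′ within′ il
  where open Interleaved W ε (clustering-run W ε (initial n) ms₀ clustering-initial goods₀)
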